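{- Let $m \in \mathbb{N}_+$ and $\theta = 1/\sqrt{m}$. For any $n \in \mathbb{N}_+$ and any $(a_1,\ldots,a_n) \in \mathbb{N}_m^n$ (where $\mathbb{N}_m = \{m, m+1, \ldots\}$): (i) $q_n(a_1,\ldots,a_n) \geq (m+1)^{\frac{n-1}{2}}$; (ii) for every $1 \le k \le n$, \[ \frac{(a_k+m)\theta}{2} \leq \frac{q_n(a_1,\ldots,a_n)}{q_{n-1}(a_1,\ldots,a_{k-1},a_{k+1},\ldots,a_n)} \leq (a_k+m)\theta . \]
   Context: For a finite sequence of positive integers $(a_1,\ldots,a_n)$, the numbers $q_j = q_j(a_1,\ldots,a_j)$ are defined by $q_{ -1} = 0$, $q_0 = 1$, and $q_j = a_j \theta q_{j-1} + q_{j-2}$ for $j \ge 1$ (so $q_n(a_1,\dots,a_n)$ is the denominator of the $n$-th convergent of the $\theta$-expansion $[a_1\theta, a_2\theta, \ldots, a_n\theta]$, i.e. of $1/(a_1\theta + 1/(a_2\theta + \cdots + 1/(a_n\theta)))$). In (ii), $q_{n-1}(a_1,\ldots,a_{k-1},a_{k+1},\ldots,a_n)$ denotes this quantity for the sequence of length $n-1$ obtained by deleting $a_k$. -}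

module Defs where

open import Data.Nat using (ℕ; _+_; _*_)
open import Data.Product using (_×_; _,_; proj₂)
open import Data.List using (List; foldl)

-- The θ-continuant q_j(a_1..a_j) (q_{-1}=0, q_0=1,
-- q_j = a_j θ q_{j-1} + q_{j-2}) satisfies q_j = θ^j · P_j where
-- P_{-1} = 0, P_0 = 1, P_j = a_j P_{j-1} + m P_{j-2}  (natural numbers).
-- `scaledQ m as` is P_j = q_j(as) · (√m)^j, an exact integer encoding of q_j.

qstep : ℕ → ℕ × ℕ → ℕ → ℕ × ℕ
qstep m (x , y) a = (y , a * y + m * x)

scaledQ : ℕ → List ℕ → ℕ
scaledQ m as = proj₂ (foldl (qstep m) (0 , 1) as)

{-# OPTIONS --safe #-}
module Submission where

-- With P = scaledQ, the fold of qstep is linear in its start state.  So if (x , y) is the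
-- state reached after a prefix L and (r′ , r) = (scaledQ′ m R , scaledQ m R), then
-- P (L ++ R) = x r′ + y r and P (L ++ a ∷ R) = y r′ + (a y + m x) r.  Entries ≥ m give
-- m x ≤ y and r′ ≤ r, which turn both bounds of (ii) into elementary inequalities (the upper
-- one is a rearrangement inequality).  For (i), P grows by a factor ≥ m (m + 1) every two entries.

open import Defs
open import Data.Nat using (ℕ; suc; _+_; _*_; _^_; _≤_; z≤n; s≤s; NonZero; >-nonZero)
open import Data.Nat.Properties
open import Data.Nat.Tactic.RingSolver using (solve-∀)
open import Data.Product using (_×_; _,_; proj₂)
open import Data.Fin using (Fin; zero; suc)
open import Data.Vec using (Vec; []; _∷_; lookup; removeAt; toList)
open import Data.Vec.Relation.Unary.All as Vec using ([]; _∷_)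
open import Data.Vec.Relation.Unary.All.Properties using (lookup⁻; toList⁺)
open import Data.List using (List; []; _∷_; foldl)
open import Data.List.Relation.Unary.All using (All; []; _∷_)
open import Relation.Binary.PropositionalEquality using (_≡_; refl; sym; cong₂; subst; module ≡-Reasoning)

private
  variable
    m n a b u v x y r r′ : ℕ
    as : List ℕ

scaledQFrom : ℕ → ℕ × ℕ → List ℕ → ℕ
scaledQFrom m s as = proj₂ (foldl (qstep m) s as)

-- Started from (q₋₁ , q₀) = (1 , 0), so that scaledQ′ m (a ∷ as) = m * scaledQ m as.
scaledQ′ : ℕ → List ℕ → ℕ
scaledQ′ m = scaledQFrom m (1 , 0)

scaledQFrom-linear : ∀ m x y as →
  scaledQFrom m (x , y) as ≡ x * scaledQ′ m as + y * scaledQ m as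
scaledQFrom-linear m x y [] = unit x y
  where
  unit : ∀ x y → y ≡ x * 0 + y * 1
  unit = solve-∀
scaledQFrom-linear m x y (a ∷ as) = begin
  scaledQFrom m (y , a * y + m * x) as      ≡⟨ scaledQFrom-linear m y (a * y + m * x) as ⟩
  y * Q′ + (a * y + m * x) * Q              ≡⟨ regroup m x y a Q′ Q ⟩
  x * (0 * Q′ + (a * 0 + m * 1) * Q) + y * (1 * Q′ + (a * 1 + m * 0) * Q)
    ≡⟨ sym (cong₂ (λ u v → x * u + y * v)
         (scaledQFrom-linear m 0 (a * 0 + m * 1) as) (scaledQFrom-linear m 1 (a * 1 + m * 0) as)) ⟩
  x * scaledQ′ m (a ∷ as) + y * scaledQ m (a ∷ as) ∎
  where
  open ≡-Reasoning
  Q′ = scaledQ′ m as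
  Q = scaledQ m as
  regroup : ∀ m x y a Q′ Q → y * Q′ + (a * y + m * x) * Q
    ≡ x * (0 * Q′ + (a * 0 + m * 1) * Q) + y * (1 * Q′ + (a * 1 + m * 0) * Q)
  regroup = solve-∀

scaledQ′≤scaledQ : All (m ≤_) as → scaledQ′ m as ≤ scaledQ m as
scaledQ′≤scaledQ [] = z≤n
scaledQ′≤scaledQ {m} {a ∷ as} (m≤a ∷ _) = begin
  scaledQ′ m (a ∷ as)                ≡⟨ scaledQFrom-linear m 0 (a * 0 + m * 1) as ⟩
  0 * Q′ + (a * 0 + m * 1) * Q       ≡⟨ shift m a Q′ Q ⟩
  m * Q                              ≤⟨ *-monoˡ-≤ Q m≤a ⟩
  a * Q                              ≤⟨ m≤n+m (a * Q) Q′ ⟩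
  Q′ + a * Q                         ≡⟨ unshift m a Q′ Q ⟩
  1 * Q′ + (a * 1 + m * 0) * Q       ≡⟨ scaledQFrom-linear m 1 (a * 1 + m * 0) as ⟨
  scaledQ m (a ∷ as)                 ∎
  where
  open ≤-Reasoning
  Q′ = scaledQ′ m as
  Q = scaledQ m as
  shift : ∀ m a Q′ Q → 0 * Q′ + (a * 0 + m * 1) * Q ≡ m * Q
  shift = solve-∀
  unshift : ∀ m a Q′ Q → Q′ + a * Q ≡ 1 * Q′ + (a * 1 + m * 0) * Q
  unshift = solve-∀

scaledQ-two-steps : m ≤ a → m ≤ b → m * suc m * scaledQ m as ≤ scaledQ m (a ∷ b ∷ as)
scaledQ-two-steps {m} {a} {b} {as} m≤a m≤b = begin
  m * suc m * Q                                       ≡⟨ expand m Q ⟩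
  (m * m + m) * Q                                     ≤⟨ *-monoˡ-≤ Q (+-monoˡ-≤ m (*-mono-≤ m≤b m≤a)) ⟩
  (b * a + m) * Q                                     ≤⟨ m≤n+m _ (a * Q′) ⟩
  a * Q′ + (b * a + m) * Q                            ≡⟨ pad m a b Q′ Q ⟩
  a′ * Q′ + (b * a′ + m * 1) * Q                      ≡⟨ scaledQFrom-linear m a′ (b * a′ + m * 1) as ⟨
  scaledQ m (a ∷ b ∷ as)                              ∎
  where
  open ≤-Reasoning
  Q′ = scaledQ′ m as
  Q = scaledQ m as
  a′ = a * 1 + m * 0
  expand : ∀ m Q → m * suc m * Q ≡ (m * m + m) * Q
  expand = solve-∀
  pad : ∀ m a b Q′ Q →
    a * Q′ + (b * a + m) * Q ≡ (a * 1 + m * 0) * Q′ + (b * (a * 1 + m * 0) + m * 1) * Q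
  pad = solve-∀

-- The gap is (y ∸ u) * (r ∸ v).
rearrangement : u ≤ y → v ≤ r → y * v + u * r ≤ y * r + u * v
rearrangement {u} {v = v} u≤y v≤r with m≤n⇒∃[o]m+o≡n u≤y | m≤n⇒∃[o]m+o≡n v≤r
... | d , refl | e , refl = begin
  (u + d) * v + u * (v + e)                 ≤⟨ m≤m+n _ (d * e) ⟩
  (u + d) * v + u * (v + e) + d * e         ≡⟨ expand u d v e ⟩
  (u + d) * (v + e) + u * v                 ∎
  where
  open ≤-Reasoning
  expand : ∀ u d v e → (u + d) * v + u * (v + e) + d * e ≡ (u + d) * (v + e) + u * v
  expand = solve-∀

module _ .{{_ : NonZero m}} where

  insertion-≤ : m * x ≤ y → r′ ≤ r →
    y * r′ + (a * y + m * x) * r ≤ (a + m) * (x * r′ + y * r)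
  insertion-≤ {x} {y} {r′} {r} {a} mx≤y r′≤r = begin
    y * r′ + (a * y + m * x) * r                 ≡⟨ separate m a x y r′ r ⟩
    a * y * r + (y * r′ + m * x * r)             ≤⟨ +-monoʳ-≤ (a * y * r) (rearrangement mx≤y r′≤r) ⟩
    a * y * r + (y * r + m * x * r′)             ≤⟨ +-monoʳ-≤ (a * y * r) (+-mono-≤ (m≤n*m (y * r) m) mxr′≤[a+m]xr′) ⟩
    a * y * r + (m * (y * r) + (a + m) * x * r′) ≡⟨ collect m a x y r′ r ⟩
    (a + m) * (x * r′ + y * r)                   ∎
    where
    open ≤-Reasoning
    mxr′≤[a+m]xr′ : m * x * r′ ≤ (a + m) * x * r′
    mxr′≤[a+m]xr′ = *-monoˡ-≤ r′ (*-monoˡ-≤ x (m≤n+m m a))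
    separate : ∀ m a x y r′ r → y * r′ + (a * y + m * x) * r ≡ a * y * r + (y * r′ + m * x * r)
    separate = solve-∀
    collect : ∀ m a x y r′ r → a * y * r + (m * (y * r) + (a + m) * x * r′) ≡ (a + m) * (x * r′ + y * r)
    collect = solve-∀

  insertion-≥ : m ≤ a → m * x ≤ y → r′ ≤ r →
    (a + m) * (x * r′ + y * r) ≤ 2 * (y * r′ + (a * y + m * x) * r)
  insertion-≥ {x = x} {y} {r′} {r} m≤a mx≤y r′≤r with m≤n⇒∃[o]m+o≡n m≤a
  ... | c , refl = begin
    (m + c + m) * (x * r′ + y * r)                                    ≡⟨ separate m c x y r′ r ⟩
    c * (x * r′ + y * r) + 2 * (m * x * r′ + m * (y * r))             ≤⟨ +-mono-≤ (*-monoʳ-≤ c (+-monoˡ-≤ (y * r) xr′≤yr))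
                                                                                   (*-monoʳ-≤ 2 (+-monoˡ-≤ (m * (y * r)) (*-monoˡ-≤ r′ mx≤y))) ⟩
    c * (y * r + y * r) + 2 * (y * r′ + m * (y * r))                  ≤⟨ m≤m+n _ (2 * (m * x * r)) ⟩
    c * (y * r + y * r) + 2 * (y * r′ + m * (y * r)) + 2 * (m * x * r) ≡⟨ collect m c x y r′ r ⟩
    2 * (y * r′ + ((m + c) * y + m * x) * r)                          ∎
    where
    open ≤-Reasoning
    xr′≤yr : x * r′ ≤ y * r
    xr′≤yr = *-mono-≤ (≤-trans (m≤n*m x m) mx≤y) r′≤r
    separate : ∀ m c x y r′ r →
      (m + c + m) * (x * r′ + y * r) ≡ c * (x * r′ + y * r) + 2 * (m * x * r′ + m * (y * r))
    separate = solve-∀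
    collect : ∀ m c x y r′ r → c * (y * r + y * r) + 2 * (y * r′ + m * (y * r)) + 2 * (m * x * r)
      ≡ 2 * (y * r′ + ((m + c) * y + m * x) * r)
    collect = solve-∀

Sandwiched : ℕ → ℕ → ℕ → Set
Sandwiched c P P′ = c * P′ ≤ 2 * P × P ≤ c * P′

-- The entries before a_k are absorbed into the start state (x , y).
removeAt-sandwiched : .{{_ : NonZero m}} → m * x ≤ y → {as : Vec ℕ (suc n)} → Vec.All (m ≤_) as →
  (k : Fin (suc n)) →
  Sandwiched (lookup as k + m) (scaledQFrom m (x , y) (toList as))
                               (scaledQFrom m (x , y) (toList (removeAt as k)))
removeAt-sandwiched {m} {x} {y} mx≤y {a ∷ as} (m≤a ∷ hs) zero
  rewrite scaledQFrom-linear m y (a * y + m * x) (toList as) | scaledQFrom-linear m x y (toList as)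
  = insertion-≥ m≤a mx≤y r′≤r , insertion-≤ {a = a} mx≤y r′≤r
  where
  r′≤r : scaledQ′ m (toList as) ≤ scaledQ m (toList as)
  r′≤r = scaledQ′≤scaledQ (toList⁺ hs)
removeAt-sandwiched {m} {x} {y} mx≤y {b ∷ as@(_ ∷ _)} (m≤b ∷ hs) (suc k) =
  removeAt-sandwiched (≤-trans (*-monoˡ-≤ y m≤b) (m≤m+n (b * y) (m * x))) {as} hs k

scaledQ-growth : .{{_ : NonZero m}} → {as : Vec ℕ n} → Vec.All (m ≤_) as →
  m ^ n * suc m ^ n ≤ scaledQ m (toList as) ^ 2 * suc m
scaledQ-growth [] = s≤s z≤n
scaledQ-growth {m} {as = a ∷ []} (m≤a ∷ []) = begin
  m * 1 * (suc m * 1)                      ≡⟨ drop-units m ⟩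
  m * suc m                                ≤⟨ *-monoˡ-≤ (suc m) (≤-trans (m≤m*n m m) (*-mono-≤ m≤a m≤a)) ⟩
  a * a * suc m                            ≡⟨ add-units m a ⟩
  (a * 1 + m * 0) ^ 2 * suc m              ∎
  where
  open ≤-Reasoning
  drop-units : ∀ m → m * 1 * (suc m * 1) ≡ m * suc m
  drop-units = solve-∀
  add-units : ∀ m a → a * a * suc m ≡ (a * 1 + m * 0) * ((a * 1 + m * 0) * 1) * suc m
  add-units = solve-∀
scaledQ-growth {m} {n = suc (suc n)} {a ∷ b ∷ as} (m≤a ∷ m≤b ∷ hs) = begin
  m * (m * m ^ n) * (suc m * (suc m * suc m ^ n))  ≡⟨ regroup m (m ^ n) (suc m ^ n) ⟩
  M * M * (m ^ n * suc m ^ n)                      ≤⟨ *-monoʳ-≤ (M * M) (scaledQ-growth hs) ⟩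
  M * M * (Q * (Q * 1) * suc m)                    ≡⟨ square-product m Q ⟩
  M * Q * (M * Q * 1) * suc m                      ≤⟨ *-monoˡ-≤ (suc m) (^-monoˡ-≤ 2 (scaledQ-two-steps {as = toList as} m≤a m≤b)) ⟩
  scaledQ m (toList (a ∷ b ∷ as)) ^ 2 * suc m      ∎
  where
  open ≤-Reasoning
  M = m * suc m
  Q = scaledQ m (toList as)
  regroup : ∀ m p q → m * (m * p) * (suc m * (suc m * q)) ≡ m * suc m * (m * suc m) * (p * q)
  regroup = solve-∀
  square-product : ∀ m Q → m * suc m * (m * suc m) * (Q * (Q * 1) * suc m)
    ≡ m * suc m * Q * (m * suc m * Q * 1) * suc m
  square-product = solve-∀

scaledQ-square-bound : .{{_ : NonZero m}} → {as : Vec ℕ (suc n)} → Vec.All (m ≤_) as →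
  m ^ suc n * (m + 1) ^ n ≤ scaledQ m (toList as) ^ 2
scaledQ-square-bound {m} {n} {as} hs rewrite +-comm m 1 = *-cancelʳ-≤ _ _ (suc m) (begin
  m ^ suc n * suc m ^ n * suc m     ≡⟨ shift m (m ^ n) (suc m ^ n) ⟩
  m ^ suc n * suc m ^ suc n         ≤⟨ scaledQ-growth hs ⟩
  scaledQ m (toList as) ^ 2 * suc m ∎)
  where
  open ≤-Reasoning
  shift : ∀ m p q → m * p * q * suc m ≡ m * p * (suc m * q)
  shift = solve-∀

lemma3p1 : (m : ℕ) → 1 ≤ m → (n : ℕ) → (as : Vec ℕ (suc n)) →
    ((k : Fin (suc n)) → m ≤ lookup as k) →
    (m ^ suc n * (m + 1) ^ n ≤ scaledQ m (toList as) ^ 2)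
    × ((k : Fin (suc n)) →
        ((lookup as k + m) * scaledQ m (toList (removeAt as k)) ≤ 2 * scaledQ m (toList as))
        × (scaledQ m (toList as) ≤ (lookup as k + m) * scaledQ m (toList (removeAt as k))))
lemma3p1 m 1≤m n as m≤as = scaledQ-square-bound hs , removeAt-sandwiched m*0≤1 hs
  where
  instance
    m≢0 : NonZero m
    m≢0 = >-nonZero 1≤m
  hs : Vec.All (m ≤_) as
  hs = lookup⁻ m≤as
  m*0≤1 : m * 0 ≤ 1
  m*0≤1 = subst (_≤ 1) (sym (*-zeroʳ m)) z≤n
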